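{- (1) For every $H\in\mathcal{H}$, $K_{1,3}\le H$. (2) If $H\in\mathcal{H}$ and $H\le K_{1,3}$, then $H=K_{1,3}$ or $H=K^+_{1,3}$. In particular, $\{K_{1,3},K^+_{1,3}\}$ is the minimum element of the partially ordered set $(\mathcal{H}/\!\equiv,\le)$.
   Context: All graphs are finite and simple, considered up to isomorphism (so "$H=K_{1,3}$" means $H$ is isomorphic to $K_{1,3}$). An edge-colored graph is a pair $(G,c)$ with $c\colon E(G)\to\mathbb{N}$ an arbitrary map (not necessarily proper); it is colored in $t$ or more colors if $|c(E(G))|\ge t$. A subgraph (not necessarily induced) is rainbow if its edges receive pairwise distinct colors. $(G,c)$ is rainbow $H$-free if $G$ contains no rainbow subgraph isomorphic to $H$. For graphs $H_1,H_2$, write $H_1\le H_2$ if there is a positive integer $t$ such that every rainbow $H_1$-free edge-colored complete graph colored in $t$ or more colors is rainbow $H_2$-free. $\mathcal{H}$ denotes the set of connected finite simple graphs other than the paths $P_1,P_2,P_3,P_4$ ($P_k$ is the path on $k$ vertices). On $\mathcal{H}$, $H_1\equiv H_2$ means $H_1\le H_2$ and $H_2\le H_1$; for equivalence classes $\mathcal{A},\mathcal{B}$, $\mathcal{A}\le\mathcal{B}$ means $H_1\le H_2$ for some $H_1\in\mathcal{A}$, $H_2\in\mathcal{B}$; this is a partial order on $\mathcal{H}/\!\equiv$. $K_{1,k}$ is the star with $k$ leaves, and $K^+_{1,k}$ is obtained from $K_{1,k}$ by subdividing one edge with one new vertex. -}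

module Defs where

open import Data.Nat using (ℕ; zero; suc; _≥_)
open import Data.Fin using (Fin; zero; suc)
open import Data.Bool using (Bool; true; false; _∧_; _∨_; not)
open import Data.Product using (Σ; _×_; _,_; proj₁; proj₂; ∃)
open import Data.Sum using (_⊎_)
open import Relation.Binary.PropositionalEquality using (_≡_; _≢_)
open import Relation.Nullary using (¬_)

record Graph : Set where
  field
    size   : ℕ
    adj    : Fin size → Fin size → Bool
    sym    : ∀ u v → adj u v ≡ adj v u
    irrefl : ∀ u → adj u u ≡ false
open Graph public

Edge : (G : Graph) → Fin (size G) → Fin (size G) → Set
Edge G u v = adj G u v ≡ true

record _≅_ (G H : Graph) : Set where
  field
    to      : Fin (size G) → Fin (size H)
    from    : Fin (size H) → Fin (size G)
    from-to : ∀ u → from (to u) ≡ u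
    to-from : ∀ v → to (from v) ≡ v
    pres    : ∀ u v → adj H (to u) (to v) ≡ adj G u v

data Reach (G : Graph) : Fin (size G) → Fin (size G) → Set where
  here : ∀ {u} → Reach G u u
  step : ∀ {u v w} → Edge G u v → Reach G v w → Reach G u w

Connected : Graph → Set
Connected G = (size G ≥ 1) × (∀ u v → Reach G u v)

-- Edge colorings of the complete graph K_n: a symmetric map on pairs of
-- vertices; values on the diagonal are irrelevant (they are never used).
record Coloring (n : ℕ) : Set where
  field
    col     : Fin n → Fin n → ℕ
    col-sym : ∀ u v → col u v ≡ col v u
open Coloring public

ColoredInAtLeast : ∀ {n} → Coloring n → ℕ → Set
ColoredInAtLeast {n} c t =
  Σ (Fin t → Fin n × Fin n) λ e →
    (∀ i → proj₁ (e i) ≢ proj₂ (e i)) ×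
    (∀ i j → col c (proj₁ (e i)) (proj₂ (e i)) ≡ col c (proj₁ (e j)) (proj₂ (e j)) → i ≡ j)

-- A rainbow copy of H in (K_n, c): an injective vertex map (any such map
-- gives a subgraph of K_n isomorphic to H) whose image edges have pairwise
-- distinct colors.
RainbowCopy : (H : Graph) → ∀ {n} → Coloring n → Set
RainbowCopy H {n} c =
  Σ (Fin (size H) → Fin n) λ f →
    (∀ u v → f u ≡ f v → u ≡ v) ×
    (∀ u v u' v' → Edge H u v → Edge H u' v' →
       col c (f u) (f v) ≡ col c (f u') (f v') →
       (u ≡ u' × v ≡ v') ⊎ (u ≡ v' × v ≡ u'))

RainbowFree : (H : Graph) → ∀ {n} → Coloring n → Set
RainbowFree H c = ¬ RainbowCopy H c

_≼_ : Graph → Graph → Set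
H₁ ≼ H₂ = Σ ℕ λ t → ∀ n (c : Coloring n) →
  ColoredInAtLeast c t → RainbowFree H₁ c → RainbowFree H₂ c

∣_-_∣ : ℕ → ℕ → ℕ
∣ zero - m ∣ = m
∣ suc k - zero ∣ = suc k
∣ suc k - suc m ∣ = ∣ k - m ∣

open import Data.Fin using (toℕ)
open import Data.Nat using (_≡ᵇ_)
open import Relation.Binary.PropositionalEquality using (refl; cong)

private
  dist-sym : ∀ a b → ∣ a - b ∣ ≡ ∣ b - a ∣
  dist-sym zero zero = refl
  dist-sym zero (suc b) = refl
  dist-sym (suc a) zero = refl
  dist-sym (suc a) (suc b) = dist-sym a b
  dist-self : ∀ a → ∣ a - a ∣ ≡ 0
  dist-self zero = refl
  dist-self (suc a) = dist-self a

Path : ℕ → Graph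
Path k = record
  { size = k
  ; adj = λ i j → ∣ toℕ i - toℕ j ∣ ≡ᵇ 1
  ; sym = λ i j → cong (_≡ᵇ 1) (dist-sym (toℕ i) (toℕ j))
  ; irrefl = λ i → cong (_≡ᵇ 1) (dist-self (toℕ i))
  }

k13adj : Fin 4 → Fin 4 → Bool
k13adj zero zero = false
k13adj zero (suc _) = true
k13adj (suc _) zero = true
k13adj (suc _) (suc _) = false

K13 : Graph
K13 = record
  { size = 4 ; adj = k13adj
  ; sym = λ { zero zero → refl ; zero (suc _) → refl ; (suc _) zero → refl ; (suc _) (suc _) → refl }
  ; irrefl = λ { zero → refl ; (suc _) → refl }
  }

-- K⁺_{1,3}: center 0, leaves 1,2, and the edge 0–3 subdivided by vertex 4
-- (edges 0-1, 0-2, 0-4, 4-3).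
k13⁺adj : Fin 5 → Fin 5 → Bool
k13⁺adj i j = e (toℕ i) (toℕ j) ∨ e (toℕ j) (toℕ i)
  where
  e : ℕ → ℕ → Bool
  e 0 1 = true
  e 0 2 = true
  e 0 4 = true
  e 4 3 = true
  e _ _ = false

K13⁺ : Graph
K13⁺ = record
  { size = 5 ; adj = k13⁺adj
  ; sym = λ { zero zero → refl ; zero (suc zero) → refl ; zero (suc (suc zero)) → refl ; zero (suc (suc (suc zero))) → refl ; zero (suc (suc (suc (suc zero)))) → refl
            ; (suc zero) zero → refl ; (suc zero) (suc zero) → refl ; (suc zero) (suc (suc zero)) → refl ; (suc zero) (suc (suc (suc zero))) → refl ; (suc zero) (suc (suc (suc (suc zero)))) → refl
            ; (suc (suc zero)) zero → refl ; (suc (suc zero)) (suc zero) → refl ; (suc (suc zero)) (suc (suc zero)) → refl ; (suc (suc zero)) (suc (suc (suc zero))) → refl ; (suc (suc zero)) (suc (suc (suc (suc zero)))) → refl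
            ; (suc (suc (suc zero))) zero → refl ; (suc (suc (suc zero))) (suc zero) → refl ; (suc (suc (suc zero))) (suc (suc zero)) → refl ; (suc (suc (suc zero))) (suc (suc (suc zero))) → refl ; (suc (suc (suc zero))) (suc (suc (suc (suc zero)))) → refl
            ; (suc (suc (suc (suc zero)))) zero → refl ; (suc (suc (suc (suc zero)))) (suc zero) → refl ; (suc (suc (suc (suc zero)))) (suc (suc zero)) → refl ; (suc (suc (suc (suc zero)))) (suc (suc (suc zero))) → refl ; (suc (suc (suc (suc zero)))) (suc (suc (suc (suc zero)))) → refl }
  ; irrefl = λ { zero → refl ; (suc zero) → refl ; (suc (suc zero)) → refl ; (suc (suc (suc zero))) → refl ; (suc (suc (suc (suc zero)))) → refl }
  }

InH : Graph → Set
InH H = Connected H × (∀ k → k ≥ 1 → 4 ≥ k → ¬ (H ≅ Path k))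

-- A connected graph containing none of C3, C4, P5, K14 and the double star S22 is a tree of
-- diameter at most 3 and maximum degree at most 3, hence a path on at most four vertices, K13 or
-- K13⁺. So every H in 𝓗 is K13 or K13⁺ or contains one of these five obstructions.
--
-- K13 lies in K13⁺, K14 and S22. In a rainbow-K13-free colouring a vertex with two
-- differently coloured edges has no edge of a third colour. So in a rainbow P5 or C4 the edge
-- joining the middle vertices of two edge-disjoint two-edge paths would carry a colour of each of
-- them; and with four colours every edge would be confined to the three colours of a rainbow
-- triangle.
--
-- Each obstruction has colourings of K_{4+t} with t colours and a
-- rainbow K13 but no rainbow copy of it: colour ij by max(i, j) (C3: the largest vertex of a
-- triangle sees one colour twice); colour injectively only the edges at one hub (C4, P5, S22:
-- deleting any vertex leaves two edges, which then share colour 0); colour injectively only the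
-- edges of a Hamiltonian path (K14: every vertex sees at most three colours).
--
-- K13⁺ ≤ K13 with eight colours. In a rainbow-K13⁺-free colouring with a rainbow K13 centred at x,
-- every colour other than the three among its leaves occurs at x, so x sees five colours; but then
-- an edge between two of these five neighbours completes a rainbow K13⁺.

{-# OPTIONS --safe #-}
module Submission where

open import Defs hiding (sym)
open import Data.Bool using (Bool; true; false; if_then_else_)
import Data.Bool.Properties as Boolₚ
open import Data.Empty using (⊥; ⊥-elim)
open import Data.Fin as Fin using (Fin; zero; suc; toℕ; _↑ʳ_)
open import Data.Fin.Patterns
import Data.Fin.Properties as Finₚ
open import Data.Nat as ℕ using (ℕ; zero; suc; _+_; _≤_; _<_; _⊔_)
import Data.Nat.Properties as ℕₚ
open import Data.Product using (∃; ∃₂; _×_; _,_; proj₁; proj₂)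
open import Data.Sum as Sum using (_⊎_; inj₁; inj₂; [_,_])
open import Data.Vec as Vec using (Vec; []; _∷_; lookup)
import Data.Vec.Properties as Vecₚ
open import Data.Vec.Relation.Unary.All as All using (All; []; _∷_)
import Data.Vec.Relation.Unary.All.Properties as Allₚ
open import Data.Vec.Relation.Unary.AllPairs as AllPairs using ([]; _∷_)
import Data.Vec.Relation.Unary.AllPairs.Properties as AllPairsₚ
open import Data.Vec.Relation.Unary.Any as Any using (Any; here; there)
import Data.Vec.Relation.Unary.Any.Properties as Anyₚ
open import Data.Vec.Relation.Unary.Unique.Propositional using (Unique)
import Data.Vec.Relation.Unary.Unique.Propositional.Properties as Uniqueₚ
open import Data.Vec.Membership.Propositional using (_∈_; _∉_)
open import Data.Vec.Membership.Propositional.Properties using (∈-lookup)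
open import Data.Vec.Membership.DecPropositional ℕₚ._≟_ using (_∈?_)
open import Data.Vec.Functional as Vector using (Vector)
open import Function using (_∘_)
open import Function.Bundles using (_⇔_; mk⇔; Equivalence)
open import Relation.Binary.PropositionalEquality
  using (_≡_; _≢_; refl; sym; trans; cong; cong₂; subst; subst₂; ≢-sym; module ≡-Reasoning)
open import Relation.Nullary using (¬_; Dec; yes; no)
open import Relation.Nullary.Decidable as Dec
  using (True; False; toWitness; toWitnessFalse; ⌊_⌋; ¬?; _×-dec_; _⊎-dec_; _→-dec_)

private
  variable
    k m n t : ℕ
    F G H T : Graph

V : Graph → Set
V G = Fin (size G)

edge? : (G : Graph) (u v : V G) → Dec (Edge G u v)
edge? G u v = adj G u v Boolₚ.≟ true

adjacent⇒≢ : ∀ {u v} → Edge G u v → u ≢ v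
adjacent⇒≢ {G} {u} e refl with () ← trans (sym e) (irrefl G u)

edge-sym : ∀ {u v} → Edge G u v → Edge G v u
edge-sym {G} {u} {v} e = trans (Graph.sym G v u) e

SameEdge : {A : Set} → A × A → A × A → Set
SameEdge (u , v) (u′ , v′) = (u ≡ u′ × v ≡ v′) ⊎ (u ≡ v′ × v ≡ u′)

SameEdge-sym : {A : Set} {p q : A × A} → SameEdge p q → SameEdge q p
SameEdge-sym (inj₁ (refl , refl)) = inj₁ (refl , refl)
SameEdge-sym (inj₂ (refl , refl)) = inj₂ (refl , refl)

SameEdge-trans : {A : Set} {p q r : A × A} → SameEdge p q → SameEdge q r → SameEdge p r
SameEdge-trans (inj₁ (refl , refl)) q~r                  = q~r
SameEdge-trans (inj₂ (refl , refl)) (inj₁ (refl , refl)) = inj₂ (refl , refl)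
SameEdge-trans (inj₂ (refl , refl)) (inj₂ (refl , refl)) = inj₁ (refl , refl)

sameEdge? : (p q : Fin k × Fin k) → Dec (SameEdge p q)
sameEdge? (u , v) (u′ , v′) =
  (u Finₚ.≟ u′ ×-dec v Finₚ.≟ v′) ⊎-dec (u Finₚ.≟ v′ ×-dec v Finₚ.≟ u′)

record _↪_ (F G : Graph) : Set where
  constructor embedding
  field
    map       : V F → V G
    injective : ∀ u v → map u ≡ map v → u ≡ v
    edge      : ∀ u v → Edge F u v → Edge G (map u) (map v)
open _↪_ using (map)

IsEmbedding : (F G : Graph) → (V F → V G) → Set
IsEmbedding F G f = (∀ u v → f u ≡ f v → u ≡ v) × (∀ u v → Edge F u v → Edge G (f u) (f v))

isEmbedding? : (F G : Graph) (f : V F → V G) → Dec (IsEmbedding F G f)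
isEmbedding? F G f =
  Finₚ.all? (λ u → Finₚ.all? λ v → f u Finₚ.≟ f v →-dec u Finₚ.≟ v) ×-dec
  Finₚ.all? (λ u → Finₚ.all? λ v → edge? F u v →-dec edge? G (f u) (f v))

embedded : (vs : Vec (V G) (size F)) → {True (isEmbedding? F G (lookup vs))} → F ↪ G
embedded vs {is-embedding} =
  embedding (lookup vs) (proj₁ (toWitness is-embedding)) (proj₂ (toWitness is-embedding))

any-function? : (P : Vector (Fin n) k → Set) → (∀ {f g} → (∀ i → f i ≡ g i) → P f → P g) →
                (∀ f → Dec (P f)) → Dec (∃ P)
any-function? {k = zero} P resp P? =
  Dec.map′ (_ ,_) (λ (f , p) → resp (λ ()) p) (P? λ ())
any-function? {k = suc k} P resp P? =
  Dec.map′ (λ (x , f , p) → x Vector.∷ f , p)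
           (λ (f , p) → f 0F , f ∘ suc , resp (λ { zero → refl ; (suc i) → refl }) p)
           (Finₚ.any? λ x → any-function? (P ∘ (x Vector.∷_))
             (λ f≗g → resp λ { zero → refl ; (suc i) → f≗g i }) (P? ∘ (x Vector.∷_)))

-- Opaque: abstracting over the unfolded search in a `with` is prohibitively expensive.
opaque
  _↪?_ : (F G : Graph) → Dec (F ↪ G)
  F ↪? G =
    Dec.map′ (λ (f , injective , edge) → embedding f injective edge)
             (λ e → map e , _↪_.injective e , _↪_.edge e)
             (any-function? (IsEmbedding F G) respects (isEmbedding? F G))
    where
    respects : ∀ {f g} → (∀ i → f i ≡ g i) → IsEmbedding F G f → IsEmbedding F G g
    respects {f} {g} f≗g (injective , edge) =
      (λ u v eq → injective u v (trans (f≗g u) (trans eq (sym (f≗g v))))) ,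
      (λ u v e → subst₂ (Edge G) (f≗g u) (f≗g v) (edge u v e))

↪-trans : F ↪ G → G ↪ H → F ↪ H
↪-trans (embedding f f-injective f-edge) (embedding g g-injective g-edge) =
  embedding (g ∘ f) (λ u v eq → f-injective u v (g-injective _ _ eq)) (λ u v e → g-edge _ _ (f-edge u v e))

≅⇒↪ : G ≅ H → G ↪ H
≅⇒↪ iso = embedding to (λ u v eq → trans (sym (from-to u)) (trans (cong from eq) (from-to v)))
                       (λ u v e → trans (pres u v) e)
  where open _≅_ iso

≅-sym : G ≅ H → H ≅ G
≅-sym {G} {H} iso = record
  { to = from ; from = to ; from-to = to-from ; to-from = from-to
  ; pres = λ u v → trans (sym (pres (from u) (from v))) (cong₂ (adj H) (to-from u) (to-from v))
  }
  where open _≅_ iso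

↪-rainbow : ∀ {c : Coloring n} → F ↪ H → RainbowCopy H c → RainbowCopy F c
↪-rainbow (embedding g g-injective g-edge) (f , f-injective , rainbow) =
  f ∘ g , (λ u v eq → g-injective u v (f-injective _ _ eq)) ,
  λ u v u′ v′ e e′ eq → pull (rainbow _ _ _ _ (g-edge u v e) (g-edge u′ v′ e′) eq)
  where
  pull : ∀ {u v u′ v′} → SameEdge (g u , g v) (g u′ , g v′) → SameEdge (u , v) (u′ , v′)
  pull (inj₁ (p , q)) = inj₁ (g-injective _ _ p , g-injective _ _ q)
  pull (inj₂ (p , q)) = inj₂ (g-injective _ _ p , g-injective _ _ q)

ColoredInAtLeast-≤ : ∀ {s} {c : Coloring n} → s ≤ t → ColoredInAtLeast c t → ColoredInAtLeast c s
ColoredInAtLeast-≤ s≤t (e , proper , injective) =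
  e ∘ (λ i → Fin.inject≤ i s≤t) , proper ∘ (λ i → Fin.inject≤ i s≤t) ,
  λ i j eq → Finₚ.inject≤-injective s≤t s≤t i j (injective _ _ eq)

↪⇒≼ : F ↪ H → F ≼ H
↪⇒≼ e = 0 , λ _ c _ F-free H-copy → F-free (↪-rainbow {c = c} e H-copy)

≼-trans : F ≼ G → G ≼ H → F ≼ H
≼-trans (s , F≼G) (t , G≼H) = s ⊔ t , λ n c enough F-free →
  G≼H n c (ColoredInAtLeast-≤ {c = c} (ℕₚ.m≤n⊔m s t) enough)
    (F≼G n c (ColoredInAtLeast-≤ {c = c} (ℕₚ.m≤m⊔n s t) enough) F-free)

EdgeList : ℕ → ℕ → Set
EdgeList k m = Vec (Fin k × Fin k) m

Covers : (F : Graph) → EdgeList (size F) m → Set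
Covers F es = ∀ u v → Edge F u v → Any (SameEdge (u , v)) es

covers? : (F : Graph) (es : EdgeList (size F) m) → Dec (Covers F es)
covers? F es = Finₚ.all? λ u → Finₚ.all? λ v → edge? F u v →-dec Any.any? (sameEdge? (u , v)) es

IsSimple : (k : ℕ) → (Fin k → Fin k → Bool) → Set
IsSimple k a = (∀ u v → a u v ≡ a v u) × (∀ u → a u u ≡ false)

isSimple? : (k : ℕ) (a : Fin k → Fin k → Bool) → Dec (IsSimple k a)
isSimple? k a =
  Finₚ.all? (λ u → Finₚ.all? λ v → a u v Boolₚ.≟ a v u) ×-dec Finₚ.all? (λ u → a u u Boolₚ.≟ false)

listed : EdgeList k m → Fin k → Fin k → Bool
listed es u v = ⌊ Any.any? (sameEdge? (u , v)) es ⌋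

graph : (k : ℕ) (es : EdgeList k m) → {True (isSimple? k (listed es))} → Graph
graph k es {simple} = record
  { size = k ; adj = listed es ; sym = proj₁ (toWitness simple) ; irrefl = proj₂ (toWitness simple) }

graph-covers : (es : EdgeList k m) {simple : True (isSimple? k (listed es))} →
               Covers (graph k es {simple}) es
graph-covers es u v e = toWitness (Equivalence.from Boolₚ.T-≡ e)

embedding-from-edges : {es : EdgeList (size F) m} → Covers F es → (vs : Vec (V H) (size F)) →
                       Unique vs → All (λ (a , b) → Edge H (lookup vs a) (lookup vs b)) es → F ↪ H
embedding-from-edges {H = H} covers vs uniq edges =
  embedding (lookup vs) (Uniqueₚ.lookup-injective uniq) λ u v e →
    along (Anyₚ.lookup-index (covers u v e)) (Allₚ.lookup⁺ edges (Any.index (covers u v e)))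
  where
  along : ∀ {u v a b} → SameEdge (u , v) (a , b) →
          Edge H (lookup vs a) (lookup vs b) → Edge H (lookup vs u) (lookup vs v)
  along (inj₁ (refl , refl)) e = e
  along (inj₂ (refl , refl)) e = edge-sym {H} e

edge-colour : Coloring n → Vec (Fin n) k → Fin k × Fin k → ℕ
edge-colour c vs (a , b) = col c (lookup vs a) (lookup vs b)

rainbow-from-edges : {c : Coloring n} {es : EdgeList (size F) m} → Covers F es →
                     (vs : Vec (Fin n) (size F)) → Unique vs → Unique (Vec.map (edge-colour c vs) es) →
                     RainbowCopy F c
rainbow-from-edges {F = F} {c = c} {es = es} covers vs uniq colours-unique =
  lookup vs , Uniqueₚ.lookup-injective uniq , rainbow
  where
  colour-along : ∀ {u v e} → SameEdge (u , v) e → col c (lookup vs u) (lookup vs v) ≡ edge-colour c vs e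
  colour-along (inj₁ (refl , refl)) = refl
  colour-along (inj₂ (refl , refl)) = col-sym c _ _

  listed-colour : ∀ {u v} (p : Any (SameEdge (u , v)) es) →
                  lookup (Vec.map (edge-colour c vs) es) (Any.index p) ≡ col c (lookup vs u) (lookup vs v)
  listed-colour p = trans (Vecₚ.lookup-map (Any.index p) _ es) (sym (colour-along (Anyₚ.lookup-index p)))

  rainbow : ∀ u v u′ v′ → Edge F u v → Edge F u′ v′ →
            col c (lookup vs u) (lookup vs v) ≡ col c (lookup vs u′) (lookup vs v′) →
            SameEdge (u , v) (u′ , v′)
  rainbow u v u′ v′ e e′ eq =
    SameEdge-trans (Anyₚ.lookup-index p)
      (SameEdge-sym (subst (SameEdge (u′ , v′) ∘ lookup es) (sym same-index) (Anyₚ.lookup-index p′)))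
    where
    p : Any (SameEdge (u , v)) es
    p = covers u v e

    p′ : Any (SameEdge (u′ , v′)) es
    p′ = covers u′ v′ e′

    same-index : Any.index p ≡ Any.index p′
    same-index = Uniqueₚ.lookup-injective colours-unique _ _
      (trans (listed-colour p) (trans eq (sym (listed-colour p′))))

C3-edges : EdgeList 3 3
C3-edges = (0F , 1F) ∷ (1F , 2F) ∷ (2F , 0F) ∷ []

C4-edges : EdgeList 4 4
C4-edges = (0F , 1F) ∷ (1F , 2F) ∷ (2F , 3F) ∷ (3F , 0F) ∷ []

C3 C4 K14 S22 : Graph
C3  = graph 3 C3-edges
C4  = graph 4 C4-edges
K14 = graph 5 ((0F , 1F) ∷ (0F , 2F) ∷ (0F , 3F) ∷ (0F , 4F) ∷ [])
S22 = graph 6 ((0F , 1F) ∷ (0F , 2F) ∷ (0F , 3F) ∷ (3F , 4F) ∷ (3F , 5F) ∷ [])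

triangle : ∀ {a b c} → Edge H a b → Edge H b c → Edge H c a → C3 ↪ H
triangle {H} {a} {b} {c} ab bc ca =
  embedding-from-edges (graph-covers C3-edges) (a ∷ b ∷ c ∷ [])
    ((adjacent⇒≢ {H} ab ∷ ≢-sym (adjacent⇒≢ {H} ca) ∷ []) ∷ (adjacent⇒≢ {H} bc ∷ []) ∷ [] ∷ [])
    (ab ∷ bc ∷ ca ∷ [])

square : ∀ {a b c d} → Edge H a b → Edge H b c → Edge H c d → Edge H d a → a ≢ c → b ≢ d →
         C4 ↪ H
square {H} {a} {b} {c} {d} ab bc cd da a≢c b≢d =
  embedding-from-edges (graph-covers C4-edges) (a ∷ b ∷ c ∷ d ∷ [])
    ((adjacent⇒≢ {H} ab ∷ a≢c ∷ ≢-sym (adjacent⇒≢ {H} da) ∷ []) ∷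
     (adjacent⇒≢ {H} bc ∷ b≢d ∷ []) ∷ (adjacent⇒≢ {H} cd ∷ []) ∷ [] ∷ [])
    (ab ∷ bc ∷ cd ∷ da ∷ [])

K13-edges : EdgeList 4 3
K13-edges = (0F , 1F) ∷ (0F , 2F) ∷ (0F , 3F) ∷ []

K13⁺-edges : EdgeList 5 4
K13⁺-edges = (0F , 4F) ∷ (0F , 1F) ∷ (0F , 2F) ∷ (4F , 3F) ∷ []

K13-covers : Covers K13 K13-edges
K13-covers = Dec.from-yes (covers? K13 K13-edges)

K13⁺-covers : Covers K13⁺ K13⁺-edges
K13⁺-covers = Dec.from-yes (covers? K13⁺ K13⁺-edges)

∉⇒All≢ : {A : Set} {x : A} {xs : Vec A k} → x ∉ xs → All (x ≢_) xs
∉⇒All≢ {xs = []}     _  = []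
∉⇒All≢ {xs = _ ∷ _} x∉ = x∉ ∘ here ∷ ∉⇒All≢ (x∉ ∘ there)

Unique-map⁻ : {A B : Set} (f : A → B) {xs : Vec A k} → Unique (Vec.map f xs) → Unique xs
Unique-map⁻ f {[]}     []           = []
Unique-map⁻ f {x ∷ xs} (fx∉ ∷ uniq) =
  All.map (λ fx≢fy x≡y → fx≢fy (cong f x≡y)) (Allₚ.map⁻ fx∉) ∷ Unique-map⁻ f uniq

record RainbowStar (c : Coloring n) (x : Fin n) (ys : Vec (Fin n) k) : Set where
  constructor star
  field
    centre∉ : All (x ≢_) ys
    colours : Unique (Vec.map (col c x) ys)

RainbowStar⇒Unique : ∀ {c : Coloring n} {x} {ys : Vec (Fin n) k} → RainbowStar c x ys → Unique (x ∷ ys)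
RainbowStar⇒Unique {c = c} {x} (star x∉ uniq) = x∉ ∷ Unique-map⁻ (col c x) uniq

K13-copy : ∀ {c : Coloring n} {x y₁ y₂ y₃} → RainbowStar c x (y₁ ∷ y₂ ∷ y₃ ∷ []) → RainbowCopy K13 c
K13-copy {c = c} s =
  rainbow-from-edges {F = K13} {c = c} K13-covers _ (RainbowStar⇒Unique s) (RainbowStar.colours s)

K13⁺-copy : ∀ {c : Coloring n} {x m l₁ l₂ p} → RainbowStar c x (m ∷ l₁ ∷ l₂ ∷ []) →
            All (p ≢_) (x ∷ m ∷ l₁ ∷ l₂ ∷ []) →
            All (col c m p ≢_) (Vec.map (col c x) (m ∷ l₁ ∷ l₂ ∷ [])) →
            RainbowCopy K13⁺ c
K13⁺-copy {c = c} s p∉ new =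
  rainbow-from-edges {F = K13⁺} {c = c} K13⁺-covers _ (vertices (RainbowStar⇒Unique s) p∉)
    (AllPairsₚ.++⁺ (RainbowStar.colours s) ([] ∷ []) (All.map (λ new≢ → ≢-sym new≢ ∷ []) new))
  where
  vertices : ∀ {x m l₁ l₂ p} → Unique (x ∷ m ∷ l₁ ∷ l₂ ∷ []) → All (p ≢_) (x ∷ m ∷ l₁ ∷ l₂ ∷ []) →
             Unique (x ∷ l₁ ∷ l₂ ∷ p ∷ m ∷ [])
  vertices ((x≢m ∷ x≢l₁ ∷ x≢l₂ ∷ []) ∷ (m≢l₁ ∷ m≢l₂ ∷ []) ∷ (l₁≢l₂ ∷ []) ∷ [] ∷ [])
           (p≢x ∷ p≢m ∷ p≢l₁ ∷ p≢l₂ ∷ []) =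
    (x≢l₁ ∷ x≢l₂ ∷ ≢-sym p≢x ∷ x≢m ∷ []) ∷
    (l₁≢l₂ ∷ ≢-sym p≢l₁ ∷ ≢-sym m≢l₁ ∷ []) ∷
    (≢-sym p≢l₂ ∷ ≢-sym m≢l₂ ∷ []) ∷
    (p≢m ∷ []) ∷ [] ∷ []

module Copy (F : Graph) (c : Coloring n) (copy : RainbowCopy F c) where

  f : V F → Fin n
  f = proj₁ copy

  private
    f-injective : ∀ u v → f u ≡ f v → u ≡ v
    f-injective = proj₁ (proj₂ copy)

    rainbow : ∀ u v u′ v′ → Edge F u v → Edge F u′ v′ →
              col c (f u) (f v) ≡ col c (f u′) (f v′) → SameEdge (u , v) (u′ , v′)
    rainbow = proj₂ (proj₂ copy)

  distinct : (u v : V F) → {False (u Finₚ.≟ v)} → f u ≢ f v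
  distinct u v {u≢v} eq = toWitnessFalse u≢v (f-injective u v eq)

  distinct-colours : (u v u′ v′ : V F) → {uv : True (edge? F u v)} → {u′v′ : True (edge? F u′ v′)} →
                     {different : False (sameEdge? (u , v) (u′ , v′))} →
                     col c (f u) (f v) ≢ col c (f u′) (f v′)
  distinct-colours u v u′ v′ {uv} {u′v′} {different} eq =
    toWitnessFalse different (rainbow u v u′ v′ (toWitness uv) (toWitness u′v′) eq)

  fan-colours : ∀ {u v w} → Edge F u v → Edge F u w → v ≢ w → col c (f u) (f v) ≢ col c (f u) (f w)
  fan-colours {u} {v} {w} uv uw v≢w eq with rainbow u v u w uv uw eq
  ... | inj₁ (_ , v≡w) = v≢w v≡w
  ... | inj₂ (_ , refl) = adjacent⇒≢ {F} uv refl

  rainbow-star : (u : V F) (vs : Vec (V F) k) →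
                 {adjacent : True (All.all? (edge? F u) vs)} →
                 {unique : True (AllPairs.allPairs? (λ v w → ¬? (v Finₚ.≟ w)) vs)} →
                 RainbowStar c (f u) (Vec.map f vs)
  rainbow-star u vs {adjacent} {unique} = star
    (Allₚ.map⁺ (All.map (λ uv eq → adjacent⇒≢ {F} uv (f-injective _ _ eq)) (toWitness adjacent)))
    (AllPairsₚ.map⁺ (AllPairsₚ.map⁺ (fan (toWitness adjacent) (toWitness unique))))
    where
    fan : ∀ {k} {vs : Vec (V F) k} → All (Edge F u) vs → Unique vs →
          AllPairs.AllPairs (λ v w → col c (f u) (f v) ≢ col c (f u) (f w)) vs
    fan []         []           = []
    fan (uv ∷ uvs) (v∉ ∷ uniq) =
      All.map (λ (uw , v≢w) → fan-colours uv uw v≢w) (All.zip (uvs , v∉)) ∷ fan uvs uniq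

injective⇒∃∉ : (w : Fin t → ℕ) → (∀ i j → w i ≡ w j → i ≡ j) → (L : Vec ℕ m) → m < t →
               ∃ λ i → w i ∉ L
injective⇒∃∉ w w-injective L m<t with Finₚ.any? (λ i → ¬? (w i ∈? L))
... | yes found = found
... | no  none  = ⊥-elim (collision (Finₚ.pigeonhole m<t (Any.index ∘ member)))
  where
  member : ∀ i → w i ∈ L
  member i = Dec.decidable-stable (w i ∈? L) (λ w∉ → none (i , w∉))

  collision : ¬ ∃₂ λ i j → i Fin.< j × Any.index (member i) ≡ Any.index (member j)
  collision (i , j , i<j , same-index) = Finₚ.<⇒≢ i<j (w-injective i j (begin
    w i                             ≡⟨ Anyₚ.lookup-index (member i) ⟩
    lookup L (Any.index (member i)) ≡⟨ cong (lookup L) same-index ⟩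
    lookup L (Any.index (member j)) ≡⟨ sym (Anyₚ.lookup-index (member j)) ⟩
    w j                             ∎))
    where open ≡-Reasoning

unused-colour : {c : Coloring n} → ColoredInAtLeast c t → (L : Vec ℕ m) → m < t →
                ∃₂ λ u v → u ≢ v × col c u v ∉ L
unused-colour (e , proper , injective) L m<t with injective⇒∃∉ _ injective L m<t
... | i , ∉L = proj₁ (e i) , proj₂ (e i) , proper i , ∉L

few-colours⇒small-stars : {c : Coloring n} {x : Fin n} {ys : Vec (Fin n) k} (L : Vec ℕ m) →
                          (∀ y → col c x y ∈ L) → RainbowStar c x ys → m < k → ⊥
few-colours⇒small-stars {c = c} {x} {ys} L palette (star _ uniq) m<k
  with injective⇒∃∉ (lookup (Vec.map (col c x) ys)) (Uniqueₚ.lookup-injective uniq) L m<k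
... | i , ∉L = ∉L (subst (_∈ L) (sym (Vecₚ.lookup-map i (col c x) ys)) (palette (lookup ys i)))

-- Connected graphs without the five obstructions

-- The new leaf is vertex 0; vertex i of T becomes suc i.
addLeaf : (T : Graph) → V T → Graph
addLeaf T i = record { size = suc (size T) ; adj = adj′ ; sym = sym′ ; irrefl = irrefl′ }
  where
  adj′ : Fin (suc (size T)) → Fin (suc (size T)) → Bool
  adj′ zero    zero    = false
  adj′ zero    (suc v) = ⌊ v Finₚ.≟ i ⌋
  adj′ (suc u) zero    = ⌊ u Finₚ.≟ i ⌋
  adj′ (suc u) (suc v) = adj T u v

  sym′ : ∀ u v → adj′ u v ≡ adj′ v u
  sym′ zero    zero    = refl
  sym′ zero    (suc v) = refl
  sym′ (suc u) zero    = refl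
  sym′ (suc u) (suc v) = Graph.sym T u v

  irrefl′ : ∀ u → adj′ u u ≡ false
  irrefl′ zero    = refl
  irrefl′ (suc u) = irrefl T u

extend-by-leaf : (g : T ↪ H) → ∀ {i w} → (∀ j → map g j ≢ w) → Edge H (map g i) w →
                 addLeaf T i ↪ H
extend-by-leaf {T} {H} (embedding g g-injective g-edge) {i} {w} w∉ gi~w =
  embedding g′ g′-injective g′-edge
  where
  g′ : V (addLeaf T i) → V H
  g′ zero    = w
  g′ (suc j) = g j

  g′-injective : ∀ u v → g′ u ≡ g′ v → u ≡ v
  g′-injective zero    zero    _  = refl
  g′-injective zero    (suc v) eq = ⊥-elim (w∉ v (sym eq))
  g′-injective (suc u) zero    eq = ⊥-elim (w∉ u eq)
  g′-injective (suc u) (suc v) eq = cong suc (g-injective u v eq)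

  attached : ∀ {v} → ⌊ v Finₚ.≟ i ⌋ ≡ true → v ≡ i
  attached e = toWitness (Equivalence.from Boolₚ.T-≡ e)

  g′-edge : ∀ u v → Edge (addLeaf T i) u v → Edge H (g′ u) (g′ v)
  g′-edge zero    (suc v) e with refl ← attached e = edge-sym {H} gi~w
  g′-edge (suc u) zero    e with refl ← attached e = gi~w
  g′-edge (suc u) (suc v) e = g-edge u v e

closed⇒surjective : Connected H → (g : Fin m → V H) → Fin m →
                    (∀ i w → (∀ j → g j ≢ w) → ¬ Edge H (g i) w) →
                    ∀ w → ∃ λ j → g j ≡ w
closed⇒surjective {H} (_ , reach) g i₀ closed w = walk (reach (g i₀) w) (i₀ , refl)
  where
  walk : ∀ {u w} → Reach H u w → ∃ (λ j → g j ≡ u) → ∃ λ j → g j ≡ w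
  walk here                   hit        = hit
  walk (step {v = v} u~v v⇝w) (j , refl) with Finₚ.any? (λ j′ → g j′ Finₚ.≟ v)
  ... | yes hit = walk v⇝w hit
  ... | no  v∉  = ⊥-elim (closed j v (λ j′ gj′≡v → v∉ (j′ , gj′≡v)) u~v)

↪⇒≅ : (g : T ↪ H) → (∀ w → ∃ λ j → map g j ≡ w) →
      (∀ i j → Edge H (map g i) (map g j) → Edge T i j) → H ≅ T
↪⇒≅ {T} {H} (embedding g g-injective g-edge) onto reflects = record
  { to      = λ w → proj₁ (onto w)
  ; from    = g
  ; from-to = λ w → proj₂ (onto w)
  ; to-from = λ j → g-injective _ _ (proj₂ (onto (g j)))
  ; pres    = λ u v → trans (adj-agrees (proj₁ (onto u)) (proj₁ (onto v)))
                            (cong₂ (adj H) (proj₂ (onto u)) (proj₂ (onto v)))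
  }
  where
  adj-agrees : ∀ i j → adj T i j ≡ adj H (g i) (g j)
  adj-agrees i j = Boolₚ.⇔→≡ (mk⇔ (g-edge i j) (reflects i j))

JoinedWithin3 : (T : Graph) → V T → V T → Set
JoinedWithin3 T i j =
  (∃ λ k → Edge T i k × Edge T k j) ⊎
  (∃₂ λ k l → Edge T i k × Edge T k l × Edge T l j × i ≢ l × k ≢ j)

Diameter≤3 : Graph → Set
Diameter≤3 T = ∀ i j → i ≢ j → adj T i j ≡ false → JoinedWithin3 T i j

diameter≤3? : (T : Graph) → Dec (Diameter≤3 T)
diameter≤3? T =
  Finₚ.all? λ i → Finₚ.all? λ j → ¬? (i Finₚ.≟ j) →-dec adj T i j Boolₚ.≟ false →-dec
    (Finₚ.any? (λ k → edge? T i k ×-dec edge? T k j) ⊎-dec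
     Finₚ.any? λ k → Finₚ.any? λ l → edge? T i k ×-dec edge? T k l ×-dec edge? T l j ×-dec
                                     ¬? (i Finₚ.≟ l) ×-dec ¬? (k Finₚ.≟ j))

reflects-edges : ¬ C3 ↪ H → ¬ C4 ↪ H → Diameter≤3 T → (g : T ↪ H) →
                 ∀ i j → Edge H (map g i) (map g j) → Edge T i j
reflects-edges {H} {T} ¬C3 ¬C4 short (embedding g g-injective g-edge) i j gi~gj
  with adj T i j in adjacency
... | true  = refl
... | false with i Finₚ.≟ j
...   | yes refl = ⊥-elim (adjacent⇒≢ {H} gi~gj refl)
...   | no  i≢j with short i j i≢j adjacency
...     | inj₁ (k , i~k , k~j) =
  ⊥-elim (¬C3 (triangle (g-edge _ _ i~k) (g-edge _ _ k~j) (edge-sym {H} gi~gj)))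
...     | inj₂ (k , l , i~k , k~l , l~j , i≢l , k≢j) =
  ⊥-elim (¬C4 (square (g-edge _ _ i~k) (g-edge _ _ k~l) (g-edge _ _ l~j) (edge-sym {H} gi~gj)
                      (i≢l ∘ g-injective _ _) (k≢j ∘ g-injective _ _)))

maximal⇒≅ : Connected H → ¬ C3 ↪ H → ¬ C4 ↪ H → {short : True (diameter≤3? T)} →
            V T → (g : T ↪ H) → (∀ i → ¬ addLeaf T i ↪ H) → H ≅ T
maximal⇒≅ conn ¬C3 ¬C4 {short} i₀ g no-leaf =
  ↪⇒≅ g (closed⇒surjective conn (map g) i₀ λ i w w∉ gi~w → no-leaf i (extend-by-leaf g w∉ gi~w))
        (reflects-edges ¬C3 ¬C4 (toWitness short) g)

data Obstruction : Set where
  c3 c4 p5 k14 s22 : Obstruction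

obstruction : Obstruction → Graph
obstruction c3  = C3
obstruction c4  = C4
obstruction p5  = Path 5
obstruction k14 = K14
obstruction s22 = S22

data Shape (H : Graph) : Set where
  short-path : ∀ k {1≤k : True (1 ℕ.≤? k)} {k≤4 : True (k ℕ.≤? 4)} → H ≅ Path k → Shape H
  claw       : H ≅ K13 → Shape H
  claw⁺      : H ≅ K13⁺ → Shape H
  obstructed : ∀ o → obstruction o ↪ H → Shape H

-- Without obstructions H is isomorphic to the largest of K13⁺, K13, P4, P3, P2, P1 it contains:
-- adding a leaf to any of them creates an obstruction or a larger one of them.
module Unobstructed (H : Graph) (conn : Connected H) (¬C3 : ¬ C3 ↪ H) (¬C4 : ¬ C4 ↪ H)
                    (¬P5 : ¬ Path 5 ↪ H) (¬K14 : ¬ K14 ↪ H) (¬S22 : ¬ S22 ↪ H) where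

  K13⁺-maximal : ∀ i → ¬ addLeaf K13⁺ i ↪ H
  K13⁺-maximal 0F = ¬K14 ∘ ↪-trans (embedded (1F ∷ 0F ∷ 2F ∷ 3F ∷ 5F ∷ []))
  K13⁺-maximal 1F = ¬P5  ∘ ↪-trans (embedded (0F ∷ 2F ∷ 1F ∷ 5F ∷ 4F ∷ []))
  K13⁺-maximal 2F = ¬P5  ∘ ↪-trans (embedded (0F ∷ 3F ∷ 1F ∷ 5F ∷ 4F ∷ []))
  K13⁺-maximal 3F = ¬P5  ∘ ↪-trans (embedded (0F ∷ 4F ∷ 5F ∷ 1F ∷ 2F ∷ []))
  K13⁺-maximal 4F = ¬S22 ∘ ↪-trans (embedded (1F ∷ 2F ∷ 3F ∷ 5F ∷ 0F ∷ 4F ∷ []))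

  K13-maximal : ¬ K13⁺ ↪ H → ∀ i → ¬ addLeaf K13 i ↪ H
  K13-maximal ¬K13⁺ 0F = ¬K14  ∘ ↪-trans (embedded (1F ∷ 0F ∷ 2F ∷ 3F ∷ 4F ∷ []))
  K13-maximal ¬K13⁺ 1F = ¬K13⁺ ∘ ↪-trans (embedded (1F ∷ 3F ∷ 4F ∷ 0F ∷ 2F ∷ []))
  K13-maximal ¬K13⁺ 2F = ¬K13⁺ ∘ ↪-trans (embedded (1F ∷ 2F ∷ 4F ∷ 0F ∷ 3F ∷ []))
  K13-maximal ¬K13⁺ 3F = ¬K13⁺ ∘ ↪-trans (embedded (1F ∷ 2F ∷ 3F ∷ 0F ∷ 4F ∷ []))

  P4-maximal : ¬ K13⁺ ↪ H → ∀ i → ¬ addLeaf (Path 4) i ↪ H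
  P4-maximal ¬K13⁺ 0F = ¬P5   ∘ ↪-trans (embedded (0F ∷ 1F ∷ 2F ∷ 3F ∷ 4F ∷ []))
  P4-maximal ¬K13⁺ 1F = ¬K13⁺ ∘ ↪-trans (embedded (2F ∷ 0F ∷ 1F ∷ 4F ∷ 3F ∷ []))
  P4-maximal ¬K13⁺ 2F = ¬K13⁺ ∘ ↪-trans (embedded (3F ∷ 0F ∷ 4F ∷ 1F ∷ 2F ∷ []))
  P4-maximal ¬K13⁺ 3F = ¬P5   ∘ ↪-trans (embedded (0F ∷ 4F ∷ 3F ∷ 2F ∷ 1F ∷ []))

  P3-maximal : ¬ K13 ↪ H → ¬ Path 4 ↪ H → ∀ i → ¬ addLeaf (Path 3) i ↪ H
  P3-maximal ¬K13 ¬P4 0F = ¬P4  ∘ ↪-trans (embedded (0F ∷ 1F ∷ 2F ∷ 3F ∷ []))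
  P3-maximal ¬K13 ¬P4 1F = ¬K13 ∘ ↪-trans (embedded (2F ∷ 0F ∷ 1F ∷ 3F ∷ []))
  P3-maximal ¬K13 ¬P4 2F = ¬P4  ∘ ↪-trans (embedded (0F ∷ 3F ∷ 2F ∷ 1F ∷ []))

  P2-maximal : ¬ Path 3 ↪ H → ∀ i → ¬ addLeaf (Path 2) i ↪ H
  P2-maximal ¬P3 0F = ¬P3 ∘ ↪-trans (embedded (0F ∷ 1F ∷ 2F ∷ []))
  P2-maximal ¬P3 1F = ¬P3 ∘ ↪-trans (embedded (0F ∷ 2F ∷ 1F ∷ []))

  P1-maximal : ¬ Path 2 ↪ H → ∀ i → ¬ addLeaf (Path 1) i ↪ H
  P1-maximal ¬P2 0F = ¬P2 ∘ ↪-trans (embedded (0F ∷ 1F ∷ []))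

  P1↪H : Path 1 ↪ H
  P1↪H = embedding (λ _ → Fin.fromℕ< (proj₁ conn)) (λ { 0F 0F _ → refl }) (λ { 0F 0F () })

  maximal : {short : True (diameter≤3? T)} → V T → (g : T ↪ H) → (∀ i → ¬ addLeaf T i ↪ H) → H ≅ T
  maximal {short = short} = maximal⇒≅ conn ¬C3 ¬C4 {short}

  shape : Shape H
  shape with K13⁺ ↪? H
  ... | yes e = claw⁺ (maximal 0F e K13⁺-maximal)
  ... | no ¬K13⁺ with K13 ↪? H
  ...   | yes e = claw (maximal 0F e (K13-maximal ¬K13⁺))
  ...   | no ¬K13 with Path 4 ↪? H
  ...     | yes e = short-path 4 (maximal 0F e (P4-maximal ¬K13⁺))
  ...     | no ¬P4 with Path 3 ↪? H
  ...       | yes e = short-path 3 (maximal 0F e (P3-maximal ¬K13 ¬P4))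
  ...       | no ¬P3 with Path 2 ↪? H
  ...         | yes e = short-path 2 (maximal 0F e (P2-maximal ¬P3))
  ...         | no ¬P2 = short-path 1 (maximal 0F P1↪H (P1-maximal ¬P2))

shape : Connected H → Shape H
shape {H} conn with C3 ↪? H | C4 ↪? H | Path 5 ↪? H | K14 ↪? H | S22 ↪? H
... | yes e  | _      | _      | _       | _       = obstructed c3 e
... | no _   | yes e  | _      | _       | _       = obstructed c4 e
... | no _   | no _   | yes e  | _       | _       = obstructed p5 e
... | no _   | no _   | no _   | yes e   | _       = obstructed k14 e
... | no _   | no _   | no _   | no _    | yes e   = obstructed s22 e
... | no ¬C3 | no ¬C4 | no ¬P5 | no ¬K14 | no ¬S22 = Unobstructed.shape H conn ¬C3 ¬C4 ¬P5 ¬K14 ¬S22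

-- Rainbow-K13-free colourings

module K13-free (c : Coloring n) (free : RainbowFree K13 c) where

  third-colour : ∀ {x y₁ y₂ y} → RainbowStar c x (y₁ ∷ y₂ ∷ []) → x ≢ y →
                 col c x y ≡ col c x y₁ ⊎ col c x y ≡ col c x y₂
  third-colour {x} {y₁} {y₂} {y} (star x∉ uniq) x≢y
    with col c x y ℕₚ.≟ col c x y₁ | col c x y ℕₚ.≟ col c x y₂
  ... | yes same | _        = inj₁ same
  ... | no _     | yes same = inj₂ same
  ... | no new₁  | no new₂  =
    ⊥-elim (free (K13-copy {c = c} (star (x≢y ∷ x∉) ((new₁ ∷ new₂ ∷ []) ∷ uniq))))

  disjoint-cherries : ∀ {a a₁ a₂ b b₁ b₂} →
                      RainbowStar c a (a₁ ∷ a₂ ∷ []) → RainbowStar c b (b₁ ∷ b₂ ∷ []) → a ≢ b →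
                      col c a a₁ ≢ col c b b₁ → col c a a₁ ≢ col c b b₂ →
                      col c a a₂ ≢ col c b b₁ → col c a a₂ ≢ col c b b₂ → ⊥
  disjoint-cherries {a} {b = b} at-a at-b a≢b ≢₁₁ ≢₁₂ ≢₂₁ ≢₂₂
    with third-colour at-a a≢b | third-colour at-b (≢-sym a≢b)
  ... | inj₁ p | inj₁ q = ≢₁₁ (trans (sym p) (trans (col-sym c a b) q))
  ... | inj₁ p | inj₂ q = ≢₁₂ (trans (sym p) (trans (col-sym c a b) q))
  ... | inj₂ p | inj₁ q = ≢₂₁ (trans (sym p) (trans (col-sym c a b) q))
  ... | inj₂ p | inj₂ q = ≢₂₂ (trans (sym p) (trans (col-sym c a b) q))

  no-rainbow-P5 : RainbowFree (Path 5) c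
  no-rainbow-P5 copy =
    disjoint-cherries (rainbow-star 1F (0F ∷ 2F ∷ [])) (rainbow-star 3F (2F ∷ 4F ∷ [])) (distinct 1F 3F)
      (distinct-colours 1F 0F 3F 2F) (distinct-colours 1F 0F 3F 4F)
      (distinct-colours 1F 2F 3F 2F) (distinct-colours 1F 2F 3F 4F)
    where open Copy (Path 5) c copy

  no-rainbow-C4 : RainbowFree C4 c
  no-rainbow-C4 copy =
    disjoint-cherries (rainbow-star 0F (1F ∷ 3F ∷ [])) (rainbow-star 2F (1F ∷ 3F ∷ [])) (distinct 0F 2F)
      (distinct-colours 0F 1F 2F 1F) (distinct-colours 0F 1F 2F 3F)
      (distinct-colours 0F 3F 2F 1F) (distinct-colours 0F 3F 2F 3F)
    where open Copy C4 c copy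

  module Triangle (copy : RainbowCopy C3 c) where
    open Copy C3 c copy

    palette : Vec ℕ 3
    palette = col c (f 0F) (f 1F) ∷ col c (f 1F) (f 2F) ∷ col c (f 2F) (f 0F) ∷ []

    previous : Fin 3 → Fin 3
    previous 0F = 2F
    previous 1F = 0F
    previous 2F = 1F

    corner : ∀ i {q} → f i ≢ q →
             col c (f i) q ≡ lookup palette i ⊎ col c (f i) q ≡ lookup palette (previous i)
    corner 0F = Sum.map₂ (λ e → trans e (col-sym c _ _)) ∘ third-colour (rainbow-star 0F (1F ∷ 2F ∷ []))
    corner 1F = Sum.map₂ (λ e → trans e (col-sym c _ _)) ∘ third-colour (rainbow-star 1F (2F ∷ 0F ∷ []))
    corner 2F = Sum.map₂ (λ e → trans e (col-sym c _ _)) ∘ third-colour (rainbow-star 2F (0F ∷ 1F ∷ []))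

    in-palette : ∀ {d} i → d ≡ lookup palette i → d ∈ palette
    in-palette i refl = ∈-lookup i palette

    corner-in-palette : ∀ i {q} → f i ≢ q → col c (f i) q ∈ palette
    corner-in-palette i fi≢q = [ in-palette i , in-palette (previous i) ] (corner i fi≢q)

    apart : ∀ {p i j d d′} → col c (f i) p ≡ d → col c (f j) p ≡ d′ → d ≢ d′ →
            col c p (f i) ≢ col c p (f j)
    apart {p} {i} {j} refl refl d≢d′ eq = d≢d′ (trans (col-sym c (f i) p) (trans eq (col-sym c p (f j))))

    two-corners : ∀ {p} → (∀ i → f i ≢ p) → ∃₂ λ i j → col c p (f i) ≢ col c p (f j)
    two-corners {p} p∉ with corner 0F (p∉ 0F) | corner 1F (p∉ 1F) | corner 2F (p∉ 2F)
    ... | inj₁ e₀ | inj₁ e₁ | _       = 0F , 1F , apart e₀ e₁ (distinct-colours 0F 1F 1F 2F)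
    ... | inj₁ e₀ | inj₂ e₁ | inj₁ e₂ = 0F , 2F , apart e₀ e₂ (distinct-colours 0F 1F 2F 0F)
    ... | inj₁ e₀ | inj₂ e₁ | inj₂ e₂ = 0F , 2F , apart e₀ e₂ (distinct-colours 0F 1F 1F 2F)
    ... | inj₂ e₀ | inj₁ e₁ | _       = 0F , 1F , apart e₀ e₁ (distinct-colours 2F 0F 1F 2F)
    ... | inj₂ e₀ | inj₂ e₁ | _       = 0F , 1F , apart e₀ e₁ (distinct-colours 2F 0F 0F 1F)

    palette-complete : ∀ {p q} → p ≢ q → col c p q ∈ palette
    palette-complete {p} {q} p≢q with Finₚ.any? (λ i → f i Finₚ.≟ p)
    ... | yes (i , refl) = corner-in-palette i p≢q
    ... | no p∉ with two-corners (λ i fi≡p → p∉ (i , fi≡p))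
    ...   | i , j , apart =
      [ from-corner i , from-corner j ] (third-colour (star (p≢ i ∷ p≢ j ∷ []) ((apart ∷ []) ∷ [] ∷ [])) p≢q)
      where
      p≢ : ∀ i → p ≢ f i
      p≢ i p≡fi = p∉ (i , sym p≡fi)

      from-corner : ∀ i {d} → d ≡ col c p (f i) → d ∈ palette
      from-corner i refl = subst (_∈ palette) (col-sym c (f i) p) (corner-in-palette i (≢-sym (p≢ i)))

  no-rainbow-C3 : ColoredInAtLeast c 4 → RainbowFree C3 c
  no-rainbow-C3 enough copy with unused-colour {c = c} enough (Triangle.palette copy) ℕₚ.≤-refl
  ... | u , v , u≢v , ∉palette = ∉palette (Triangle.palette-complete copy u≢v)

-- Rainbow-K13⁺-free colourings

module K13⁺-free (c : Coloring n) (free : RainbowFree K13⁺ c) where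

  -- The last component says that a and b are among the y's.
  two-leaves-avoiding : ∀ {x y₁ y₂ y₃} → RainbowStar c x (y₁ ∷ y₂ ∷ y₃ ∷ []) → ∀ d →
    ∃₂ λ a b → RainbowStar c x (a ∷ b ∷ []) × All (d ≢_) (col c x a ∷ col c x b ∷ []) ×
               (∀ {P : Fin n → Set} → All P (y₁ ∷ y₂ ∷ y₃ ∷ []) → All P (a ∷ b ∷ []))
  two-leaves-avoiding {x} {y₁} {y₂} {y₃}
    (star (x≢₁ ∷ x≢₂ ∷ x≢₃ ∷ []) ((≢₁₂ ∷ ≢₁₃ ∷ []) ∷ (≢₂₃ ∷ []) ∷ [] ∷ [])) d
    with d ℕₚ.≟ col c x y₁ | d ℕₚ.≟ col c x y₂
  ... | yes refl | _ = y₂ , y₃ , star (x≢₂ ∷ x≢₃ ∷ []) ((≢₂₃ ∷ []) ∷ [] ∷ []) , ≢₁₂ ∷ ≢₁₃ ∷ [] ,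
                        λ { (_ ∷ p₂ ∷ p₃ ∷ []) → p₂ ∷ p₃ ∷ [] }
  ... | no d≢₁ | yes refl = y₁ , y₃ , star (x≢₁ ∷ x≢₃ ∷ []) ((≢₁₃ ∷ []) ∷ [] ∷ []) , d≢₁ ∷ ≢₂₃ ∷ [] ,
                            λ { (p₁ ∷ _ ∷ p₃ ∷ []) → p₁ ∷ p₃ ∷ [] }
  ... | no d≢₁ | no d≢₂ = y₁ , y₂ , star (x≢₁ ∷ x≢₂ ∷ []) ((≢₁₂ ∷ []) ∷ [] ∷ []) , d≢₁ ∷ d≢₂ ∷ [] ,
                          λ { (p₁ ∷ p₂ ∷ _ ∷ []) → p₁ ∷ p₂ ∷ [] }

  no-pendant-at-4-star : ∀ {x m y₁ y₂ y₃ p} → RainbowStar c x (m ∷ y₁ ∷ y₂ ∷ y₃ ∷ []) →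
                         All (p ≢_) (x ∷ m ∷ y₁ ∷ y₂ ∷ y₃ ∷ []) → col c m p ≢ col c x m → ⊥
  no-pendant-at-4-star {x} {m} {p = p} (star (x≢m ∷ x∉) (m∉ ∷ uniq)) (p≢x ∷ p≢m ∷ p∉) new
    with two-leaves-avoiding (star x∉ uniq) (col c m p)
  ... | a , b , star (x≢a ∷ x≢b ∷ []) uniq-ab , new≢a ∷ new≢b ∷ [] , sub
    with sub (Allₚ.map⁻ m∉) | sub p∉
  ...   | m≢a ∷ m≢b ∷ [] | p≢a ∷ p≢b ∷ [] =
    free (K13⁺-copy {c = c} (star (x≢m ∷ x≢a ∷ x≢b ∷ []) ((m≢a ∷ m≢b ∷ []) ∷ uniq-ab))
                            (p≢x ∷ p≢m ∷ p≢a ∷ p≢b ∷ []) (new ∷ new≢a ∷ new≢b ∷ []))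

  no-five-colour-star : ∀ {x} {zs : Vec (Fin n) 5} → ¬ RainbowStar c x zs
  no-five-colour-star {x} {z₀ ∷ z₁ ∷ _ ∷ _ ∷ _ ∷ []}
    s@(star (x≢₀ ∷ x≢₁ ∷ x∉) ((≢₀₁ ∷ ≢₀s) ∷ ≢₁s ∷ uniq))
    with RainbowStar⇒Unique s | col c z₀ z₁ ℕₚ.≟ col c x z₀
  ... | _ ∷ (z₀≢z₁ ∷ _) ∷ (z₁∉ ∷ _) | no new =
    no-pendant-at-4-star (star (x≢₀ ∷ x∉) (≢₀s ∷ uniq)) (≢-sym x≢₁ ∷ ≢-sym z₀≢z₁ ∷ z₁∉) new
  ... | _ ∷ (z₀≢z₁ ∷ z₀∉) ∷ _ | yes same =
    no-pendant-at-4-star (star (x≢₁ ∷ x∉) (≢₁s ∷ uniq)) (≢-sym x≢₀ ∷ z₀≢z₁ ∷ z₀∉)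
      (λ e → ≢₀₁ (trans (sym same) (trans (col-sym c z₀ z₁) e)))

  no-stray-colour : ∀ {x y₁ y₂ y₃ u v} → RainbowStar c x (y₁ ∷ y₂ ∷ y₃ ∷ []) →
                    x ≢ u → v ≢ x → v ≢ u → All (v ≢_) (y₁ ∷ y₂ ∷ y₃ ∷ []) →
                    (∀ z → x ≢ z → col c x z ≢ col c u v) → ⊥
  no-stray-colour {x} {u = u} {v} s x≢u v≢x v≢u v∉ absent with two-leaves-avoiding s (col c x u)
  ... | a , b , star (x≢a ∷ x≢b ∷ []) uniq-ab , u≢a ∷ u≢b ∷ [] , sub with sub v∉
  ...   | v≢a ∷ v≢b ∷ [] =
    free (K13⁺-copy {c = c} (star (x≢u ∷ x≢a ∷ x≢b ∷ []) ((u≢a ∷ u≢b ∷ []) ∷ uniq-ab))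
                            (v≢x ∷ v≢u ∷ v≢a ∷ v≢b ∷ [])
                            (≢-sym (absent u x≢u) ∷ ≢-sym (absent a x≢a) ∷ ≢-sym (absent b x≢b) ∷ []))

  inner-colours : Vec (Fin n) 3 → Vec ℕ 3
  inner-colours (y₁ ∷ y₂ ∷ y₃ ∷ []) = col c y₁ y₂ ∷ col c y₁ y₃ ∷ col c y₂ y₃ ∷ []

  ∈-inner-colours : ∀ {ys : Vec (Fin n) 3} {u v} → u ∈ ys → v ∈ ys → u ≢ v → col c u v ∈ inner-colours ys
  ∈-inner-colours {_ ∷ _ ∷ _ ∷ []} (here refl) (here refl) u≢v = ⊥-elim (u≢v refl)
  ∈-inner-colours {_ ∷ _ ∷ _ ∷ []} (here refl) (there (here refl)) _ = here refl
  ∈-inner-colours {_ ∷ _ ∷ _ ∷ []} (here refl) (there (there (here refl))) _ = there (here refl)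
  ∈-inner-colours {_ ∷ _ ∷ _ ∷ []} (there (here refl)) (here refl) _ = here (col-sym c _ _)
  ∈-inner-colours {_ ∷ _ ∷ _ ∷ []} (there (here refl)) (there (here refl)) u≢v = ⊥-elim (u≢v refl)
  ∈-inner-colours {_ ∷ _ ∷ _ ∷ []} (there (here refl)) (there (there (here refl))) _ =
    there (there (here refl))
  ∈-inner-colours {_ ∷ _ ∷ _ ∷ []} (there (there (here refl))) (here refl) _ =
    there (here (col-sym c _ _))
  ∈-inner-colours {_ ∷ _ ∷ _ ∷ []} (there (there (here refl))) (there (here refl)) _ =
    there (there (here (col-sym c _ _)))
  ∈-inner-colours {_ ∷ _ ∷ _ ∷ []} (there (there (here refl))) (there (there (here refl))) u≢v =
    ⊥-elim (u≢v refl)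

  colour-at-centre : ∀ {x y₁ y₂ y₃ u v} → RainbowStar c x (y₁ ∷ y₂ ∷ y₃ ∷ []) → u ≢ v →
                     col c u v ∉ inner-colours (y₁ ∷ y₂ ∷ y₃ ∷ []) →
                     ∃ λ z → x ≢ z × col c x z ≡ col c u v
  colour-at-centre {x} {y₁} {y₂} {y₃} {u} {v} s u≢v ∉inner
    with Finₚ.any? (λ z → ¬? (x Finₚ.≟ z) ×-dec col c x z ℕₚ.≟ col c u v)
  ... | yes found = found
  ... | no none = ⊥-elim (cases (Any.any? (v Finₚ.≟_) ys) (Any.any? (u Finₚ.≟_) ys))
    where
    ys : Vec (Fin n) 3
    ys = y₁ ∷ y₂ ∷ y₃ ∷ []

    absent : ∀ z → x ≢ z → col c x z ≢ col c u v
    absent z x≢z eq = none (z , x≢z , eq)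

    x≢u : x ≢ u
    x≢u refl = absent v u≢v refl

    x≢v : x ≢ v
    x≢v refl = absent u (≢-sym u≢v) (col-sym c v u)

    cases : Dec (v ∈ ys) → Dec (u ∈ ys) → ⊥
    cases (no v∉)  _        = no-stray-colour s x≢u (≢-sym x≢v) (≢-sym u≢v) (∉⇒All≢ v∉) absent
    cases (yes _)  (no u∉)  = no-stray-colour s x≢v (≢-sym x≢u) u≢v (∉⇒All≢ u∉)
                                (λ z x≢z eq → absent z x≢z (trans eq (col-sym c v u)))
    cases (yes v∈) (yes u∈) = ∉inner (∈-inner-colours u∈ v∈ u≢v)

  grow-star : ∀ {x y₁ y₂ y₃} → RainbowStar c x (y₁ ∷ y₂ ∷ y₃ ∷ []) → ColoredInAtLeast c t →
              {zs : Vec (Fin n) k} → RainbowStar c x zs → 3 + k < t → ∃ λ z → RainbowStar c x (z ∷ zs)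
  grow-star {x = x} {y₁} {y₂} {y₃} s enough {zs} (star x∉ uniq) 3+k<t
    with unused-colour {c = c} enough (inner-colours (y₁ ∷ y₂ ∷ y₃ ∷ []) Vec.++ Vec.map (col c x) zs) 3+k<t
  ... | u , v , u≢v , ∉L with colour-at-centre s u≢v (∉L ∘ Anyₚ.++⁺ˡ)
  ...   | z , x≢z , same =
    z , star (x≢z ∷ x∉) (∉⇒All≢ (subst (_∉ Vec.map (col c x) zs) (sym same) (∉L ∘ Anyₚ.++⁺ʳ _)) ∷ uniq)

  star-of-size : ∀ {x y₁ y₂ y₃} → RainbowStar c x (y₁ ∷ y₂ ∷ y₃ ∷ []) → ColoredInAtLeast c t →
                 ∀ k → 3 + k ≤ t → ∃ λ (zs : Vec (Fin n) k) → RainbowStar c x zs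
  star-of-size s enough zero    _     = [] , star [] []
  star-of-size s enough (suc k) 3+k<t with star-of-size s enough k (ℕₚ.<⇒≤ 3+k<t)
  ... | zs , s′ with grow-star s enough s′ 3+k<t
  ...   | z , s″ = z ∷ zs , s″

  no-rainbow-K13 : ColoredInAtLeast c 8 → RainbowFree K13 c
  no-rainbow-K13 enough copy =
    no-five-colour-star (proj₂ (star-of-size (rainbow-star 0F (1F ∷ 2F ∷ 3F ∷ [])) enough 5 ℕₚ.≤-refl))
    where open Copy K13 c copy

-- Colourings with a rainbow K13 but no rainbow obstruction

Separating : Graph → Set
Separating F = ∀ t → ∃₂ λ n (c : Coloring n) → ColoredInAtLeast c t × RainbowCopy K13 c × RainbowFree F c

separating⇒⋠ : Separating F → ¬ F ≼ K13
separating⇒⋠ separating (t , F≼K13) with separating t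
... | n , c , enough , K13-copy , F-free = F≼K13 n c enough F-free K13-copy

rainbowStar? : (c : Coloring n) (x : Fin n) (ys : Vec (Fin n) k) → Dec (RainbowStar c x ys)
rainbowStar? c x ys =
  Dec.map′ (λ (x∉ , uniq) → star x∉ uniq) (λ (star x∉ uniq) → x∉ , uniq)
    (All.all? (λ y → ¬? (x Finₚ.≟ y)) ys ×-dec
     AllPairs.allPairs? (λ a b → ¬? (a ℕₚ.≟ b)) (Vec.map (col c x) ys))

claw-at : (c : Coloring n) (x : Fin n) (ys : Vec (Fin n) 3) → {True (rainbowStar? c x ys)} →
          RainbowCopy K13 c
claw-at c x (_ ∷ _ ∷ _ ∷ []) {is-star} = K13-copy {c = c} (toWitness is-star)

far : Fin t → Fin (4 + t)
far k = suc (3 ↑ʳ k)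

coloured-by-far-end : (c : Coloring (4 + t)) (e : Fin t → Fin (4 + t) × Fin (4 + t)) →
                      (∀ k → proj₁ (e k) ≢ proj₂ (e k)) →
                      (∀ k → col c (proj₁ (e k)) (proj₂ (e k)) ≡ toℕ (far k)) →
                      ColoredInAtLeast c t
coloured-by-far-end c e proper colour = e , proper , λ i j same →
  Finₚ.↑ʳ-injective 3 i j (Finₚ.suc-injective (Finₚ.toℕ-injective
    (trans (sym (colour i)) (trans same (colour j)))))

max-colouring : ∀ t → Coloring (4 + t)
max-colouring t = record { col = λ i j → toℕ i ⊔ toℕ j ; col-sym = λ i j → ℕₚ.⊔-comm (toℕ i) (toℕ j) }

⊔-triangle : ∀ a b c → a ⊔ b ≡ b ⊔ c ⊎ b ⊔ c ≡ c ⊔ a ⊎ c ⊔ a ≡ a ⊔ b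
⊔-triangle a b c with ℕₚ.≤-total a b | ℕₚ.≤-total b c | ℕₚ.≤-total c a
... | inj₁ a≤b | inj₁ b≤c | _ =
  inj₂ (inj₁ (trans (ℕₚ.m≤n⇒m⊔n≡n b≤c) (sym (ℕₚ.m≥n⇒m⊔n≡m (ℕₚ.≤-trans a≤b b≤c)))))
... | inj₁ a≤b | inj₂ c≤b | _ =
  inj₁ (trans (ℕₚ.m≤n⇒m⊔n≡n a≤b) (sym (ℕₚ.m≥n⇒m⊔n≡m c≤b)))
... | inj₂ b≤a | _ | inj₁ c≤a =
  inj₂ (inj₂ (trans (ℕₚ.m≤n⇒m⊔n≡n c≤a) (sym (ℕₚ.m≥n⇒m⊔n≡m b≤a))))
... | inj₂ b≤a | _ | inj₂ a≤c =
  inj₂ (inj₁ (trans (ℕₚ.m≤n⇒m⊔n≡n (ℕₚ.≤-trans b≤a a≤c)) (sym (ℕₚ.m≥n⇒m⊔n≡m a≤c))))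

max-separates-C3 : Separating C3
max-separates-C3 t = _ , max-colouring t ,
  coloured-by-far-end (max-colouring t) (λ k → 0F , far k) (λ _ ()) (λ _ → refl) ,
  claw-at (max-colouring t) 0F (1F ∷ 2F ∷ 3F ∷ []) , no-rainbow-C3
  where
  no-rainbow-C3 : RainbowFree C3 (max-colouring t)
  no-rainbow-C3 copy =
    [ distinct-colours 0F 1F 1F 2F , [ distinct-colours 1F 2F 2F 0F , distinct-colours 2F 0F 0F 1F ] ]
      (⊔-triangle (toℕ (f 0F)) (toℕ (f 1F)) (toℕ (f 2F)))
    where open Copy C3 (max-colouring t) copy

hub-colour : Fin n → Fin n → ℕ
hub-colour zero    j       = toℕ j
hub-colour (suc i) zero    = suc (toℕ i)
hub-colour (suc i) (suc j) = 0

hub-colouring : ∀ t → Coloring (4 + t)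
hub-colouring t = record { col = hub-colour ; col-sym = symmetric }
  where
  symmetric : ∀ i j → hub-colour i j ≡ hub-colour j i
  symmetric zero    zero    = refl
  symmetric zero    (suc j) = refl
  symmetric (suc i) zero    = refl
  symmetric (suc i) (suc j) = refl

TwoEdgesAvoiding : (F : Graph) → V F → Set
TwoEdgesAvoiding F i = ∃₂ λ a b → ∃₂ λ a′ b′ →
  Edge F a b × Edge F a′ b′ × ¬ SameEdge (a , b) (a′ , b′) × All (_≢ i) (a ∷ b ∷ a′ ∷ b′ ∷ [])

twoEdgesAvoiding? : (F : Graph) (i : V F) → Dec (TwoEdgesAvoiding F i)
twoEdgesAvoiding? F i = Finₚ.any? λ a → Finₚ.any? λ b → Finₚ.any? λ a′ → Finₚ.any? λ b′ →
  edge? F a b ×-dec edge? F a′ b′ ×-dec ¬? (sameEdge? (a , b) (a′ , b′)) ×-dec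
  All.all? (λ v → ¬? (v Finₚ.≟ i)) _

hub-separates : V F → {robust : True (Finₚ.all? (twoEdgesAvoiding? F))} → Separating F
hub-separates {F} i₀ {robust} t = _ , hub-colouring t ,
  coloured-by-far-end (hub-colouring t) (λ k → 0F , far k) (λ _ ()) (λ _ → refl) ,
  claw-at (hub-colouring t) 0F (1F ∷ 2F ∷ 3F ∷ []) , no-rainbow-F
  where
  off-hub : ∀ {u v : Fin (4 + t)} → u ≢ 0F → v ≢ 0F → hub-colour u v ≡ 0
  off-hub {zero}          u≢0 _   = ⊥-elim (u≢0 refl)
  off-hub {suc _} {zero}  _   v≢0 = ⊥-elim (v≢0 refl)
  off-hub {suc _} {suc _} _   _   = refl

  no-rainbow-F : RainbowFree F (hub-colouring t)
  no-rainbow-F (f , f-injective , rainbow) = same-colour (toWitness robust (proj₁ hub-free)) (proj₂ hub-free)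
    where
    hub-free : ∃ λ i → ∀ a → a ≢ i → f a ≢ 0F
    hub-free with Finₚ.any? (λ i → f i Finₚ.≟ 0F)
    ... | yes (i , fi≡0) = i , λ a a≢i fa≡0 → a≢i (f-injective a i (trans fa≡0 (sym fi≡0)))
    ... | no  none       = i₀ , λ a _ fa≡0 → none (a , fa≡0)

    same-colour : ∀ {i} → TwoEdgesAvoiding F i → (∀ a → a ≢ i → f a ≢ 0F) → ⊥
    same-colour (a , b , a′ , b′ , ab , a′b′ , different , a≢ ∷ b≢ ∷ a′≢ ∷ b′≢ ∷ []) off =
      different (rainbow a b a′ b′ ab a′b′
        (trans (off-hub (off a a≢) (off b b≢)) (sym (off-hub (off a′ a′≢) (off b′ b′≢)))))

∣-∣-comm : ∀ a b → ∣ a - b ∣ ≡ ∣ b - a ∣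
∣-∣-comm zero    zero    = refl
∣-∣-comm zero    (suc b) = refl
∣-∣-comm (suc a) zero    = refl
∣-∣-comm (suc a) (suc b) = ∣-∣-comm a b

∣n-1+n∣≡1 : ∀ a → ∣ a - suc a ∣ ≡ 1
∣n-1+n∣≡1 zero    = refl
∣n-1+n∣≡1 (suc a) = ∣n-1+n∣≡1 a

consecutive : ∀ a b → (∣ a - b ∣ ℕ.≡ᵇ 1) ≡ true → b ≡ suc a ⊎ a ≡ suc b
consecutive zero       (suc zero) _ = inj₁ refl
consecutive (suc zero) zero       _ = inj₂ refl
consecutive (suc a)    (suc b)    e = Sum.map (cong suc) (cong suc) (consecutive a b e)

path-colour : ℕ → ℕ → ℕ
path-colour a b = if ∣ a - b ∣ ℕ.≡ᵇ 1 then a ⊔ b else 0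

path-colour-sym : ∀ a b → path-colour a b ≡ path-colour b a
path-colour-sym a b rewrite ∣-∣-comm a b | ℕₚ.⊔-comm a b = refl

path-colour-succ : ∀ a → path-colour a (suc a) ≡ suc a
path-colour-succ a rewrite ∣n-1+n∣≡1 a = ℕₚ.m≤n⇒m⊔n≡n (ℕₚ.n≤1+n a)

path-colour-at : ∀ a b → path-colour a b ∈ (0 ∷ a ∷ suc a ∷ [])
path-colour-at a b with ∣ a - b ∣ ℕ.≡ᵇ 1 in adjacent
... | false = here refl
... | true with consecutive a b adjacent
...   | inj₁ refl = there (there (here (ℕₚ.m≤n⇒m⊔n≡n (ℕₚ.n≤1+n a))))
...   | inj₂ refl = there (here (ℕₚ.m≥n⇒m⊔n≡m (ℕₚ.n≤1+n b)))

path-colouring : ∀ t → Coloring (4 + t)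
path-colouring t = record
  { col = λ i j → path-colour (toℕ i) (toℕ j) ; col-sym = λ i j → path-colour-sym (toℕ i) (toℕ j) }

path-separates-K14 : Separating K14
path-separates-K14 t = _ , path-colouring t ,
  coloured-by-far-end (path-colouring t) (λ k → Fin.inject₁ (3 ↑ʳ k) , far k) proper colour ,
  claw-at (path-colouring t) 1F (0F ∷ 2F ∷ 3F ∷ []) , no-rainbow-K14
  where
  proper : ∀ k → Fin.inject₁ (3 ↑ʳ k) ≢ far k
  proper k eq = ℕₚ.1+n≢n (sym (trans (sym (Finₚ.toℕ-inject₁ (3 ↑ʳ k))) (cong toℕ eq)))

  colour : ∀ k → path-colour (toℕ (Fin.inject₁ (3 ↑ʳ k))) (toℕ (far k)) ≡ toℕ (far k)
  colour k = trans (cong (λ a → path-colour a (toℕ (far k))) (Finₚ.toℕ-inject₁ (3 ↑ʳ k)))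
                   (path-colour-succ (toℕ (3 ↑ʳ k)))

  no-rainbow-K14 : RainbowFree K14 (path-colouring t)
  no-rainbow-K14 copy =
    few-colours⇒small-stars (0 ∷ _ ∷ _ ∷ []) (λ y → path-colour-at (toℕ (f 0F)) (toℕ y))
      (rainbow-star 0F (1F ∷ 2F ∷ 3F ∷ 4F ∷ [])) ℕₚ.≤-refl
    where open Copy K14 (path-colouring t) copy

separating : ∀ o → Separating (obstruction o)
separating c3  = max-separates-C3
separating c4  = hub-separates {C4} 0F
separating p5  = hub-separates {Path 5} 0F
separating k14 = path-separates-K14
separating s22 = hub-separates {S22} 0F

K13↪K13⁺ : K13 ↪ K13⁺
K13↪K13⁺ = embedded (0F ∷ 1F ∷ 2F ∷ 4F ∷ [])

K13↪K14 : K13 ↪ K14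
K13↪K14 = embedded (0F ∷ 1F ∷ 2F ∷ 3F ∷ [])

K13↪S22 : K13 ↪ S22
K13↪S22 = embedded (0F ∷ 1F ∷ 2F ∷ 3F ∷ [])

K13≼obstruction : ∀ o → K13 ≼ obstruction o
K13≼obstruction c3  = 4 , λ _ c enough free → K13-free.no-rainbow-C3 c free enough
K13≼obstruction c4  = 0 , λ _ c _ free → K13-free.no-rainbow-C4 c free
K13≼obstruction p5  = 0 , λ _ c _ free → K13-free.no-rainbow-P5 c free
K13≼obstruction k14 = ↪⇒≼ K13↪K14
K13≼obstruction s22 = ↪⇒≼ K13↪S22

K13⁺≼K13 : K13⁺ ≼ K13
K13⁺≼K13 = 8 , λ _ c enough free → K13⁺-free.no-rainbow-K13 c free enough

claws≼K13 : H ≅ K13 ⊎ H ≅ K13⁺ → H ≼ K13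
claws≼K13     (inj₁ H≅K13)  = ↪⇒≼ (≅⇒↪ H≅K13)
claws≼K13 {H} (inj₂ H≅K13⁺) = ≼-trans {H} {K13⁺} {K13} (↪⇒≼ (≅⇒↪ H≅K13⁺)) K13⁺≼K13

K13-minimum : (H : Graph) → InH H → K13 ≼ H
K13-minimum H (conn , not-short-path) with shape conn
... | short-path k {1≤k} {k≤4} iso = ⊥-elim (not-short-path k (toWitness 1≤k) (toWitness k≤4) iso)
... | claw  iso      = ↪⇒≼ (≅⇒↪ (≅-sym iso))
... | claw⁺ iso      = ↪⇒≼ (↪-trans K13↪K13⁺ (≅⇒↪ (≅-sym iso)))
... | obstructed o e = ≼-trans {K13} {obstruction o} {H} (K13≼obstruction o) (↪⇒≼ e)

below-K13 : (H : Graph) → InH H → H ≼ K13 → H ≅ K13 ⊎ H ≅ K13⁺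
below-K13 H (conn , not-short-path) H≼K13 with shape conn
... | short-path k {1≤k} {k≤4} iso = ⊥-elim (not-short-path k (toWitness 1≤k) (toWitness k≤4) iso)
... | claw  iso      = inj₁ iso
... | claw⁺ iso      = inj₂ iso
... | obstructed o e =
  ⊥-elim (separating⇒⋠ {obstruction o} (separating o) (≼-trans {obstruction o} {H} {K13} (↪⇒≼ e) H≼K13))

theorem16 : ((H : Graph) → InH H → K13 ≼ H) ×
    ((H : Graph) → InH H → H ≼ K13 → (H ≅ K13) ⊎ (H ≅ K13⁺)) ×
    ((H : Graph) → InH H → ((H ≼ K13) × (K13 ≼ H)) ⇔ ((H ≅ K13) ⊎ (H ≅ K13⁺)))
theorem16 =
  K13-minimum ,
  below-K13 ,
  λ H H∈𝓗 → mk⇔ (λ (H≼K13 , _) → below-K13 H H∈𝓗 H≼K13) (λ claws → claws≼K13 {H} claws , K13-minimum H H∈𝓗)
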